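{- For every $\varepsilon>0$ and every positive integer $r$ there exists $n_0>0$ such that the following holds for every integer $n\ge n_0$. Let $A_1,\ldots,A_r$ be maximal sum-free subsets of $[n]$, let $C\subseteq[r]$ be such that $A_i$ is of type (a) for every $i\in C$ and $A_i$ is of type (b) or (c) for every $i\in[r]\setminus C$, and let $a=\frac1n\sum_{i\in[r]\setminus C}\left(\lceil n/2\rceil-|A_i|\right)$. Suppose that for some $k\le r$ the sets $A_1,\ldots,A_k$ are of type (c) and $[k]\cap C=\emptyset$. Then $$d\Big(\bigcap_{i\in[k]}A_i\Big)\ge\frac12-ka-\varepsilon.$$
   Context: $[n]=\{1,\ldots,n\}$ and $d(X)=|X|/n$ for $X\subseteq[n]$. A Schur triple in $X\subseteq\mathbb{Z}$ is a triple $\{x,y,z\}\subseteq X$ of not necessarily distinct elements with $x+y=z$; a set is sum-free if it contains no Schur triple, and a sum-free subset of $[n]$ is maximal if it is not properly contained in another sum-free subset of $[n]$. A sum-free set $X\subseteq[n]$ is of type (a) if $|X|\le 2n/5+1$; of type (b) if all its elements are odd; of type (c) if $|X|\le\min(X)$. -}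

module Defs where

open import Data.Bool using (Bool; true; false; if_then_else_)
open import Data.Nat as ℕ using (ℕ; zero; suc; _+_; _*_; _≤_; _<_; ⌈_/2⌉; _%_)
open import Data.Integer as ℤ using (ℤ; +_)
open import Data.Rational as ℚ using (ℚ; 0ℚ)
open import Data.Fin using (Fin; toℕ; inject≤)
import Data.Fin as Fin
open import Data.Fin.Subset using (Subset; _∈_; _∉_; _⊆_; ∣_∣; ⋂)
open import Data.Vec using (lookup)
import Data.List as List
open import Data.Sum using (_⊎_)
open import Relation.Binary.PropositionalEquality using (_≡_; _≢_)

-- Convention: a subset X of [n] = {1,…,n} is a Subset n (= Vec Bool n);
-- the index i : Fin n stands for the integer toℕ i + 1.
val : {n : ℕ} → Fin n → ℕ
val i = suc (toℕ i)

SumFree : {n : ℕ} → Subset n → Set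
SumFree {n} X = (i j k : Fin n) → i ∈ X → j ∈ X → k ∈ X → val i + val j ≢ val k

MaximalSumFree : {n : ℕ} → Subset n → Set
MaximalSumFree {n} X = SumFree X × ((Y : Subset n) → X ⊆ Y → SumFree Y → Y ⊆ X)
  where open import Data.Product using (_×_)

-- type (a): |X| ≤ 2n/5 + 1, i.e. 5|X| ≤ 2n + 5
TypeA : {n : ℕ} → Subset n → Set
TypeA {n} X = 5 * ∣ X ∣ ≤ 2 * n + 5

TypeB : {n : ℕ} → Subset n → Set
TypeB {n} X = (i : Fin n) → i ∈ X → val i % 2 ≡ 1

-- type (c): |X| ≤ min(X), i.e. |X| ≤ x for every x ∈ X
TypeC : {n : ℕ} → Subset n → Set
TypeC {n} X = (i : Fin n) → i ∈ X → ∣ X ∣ ≤ val i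

-- the rational z / n (with the harmless convention z / 0 = 0; only used for n ≥ 1)
ratio : ℤ → ℕ → ℚ
ratio z zero = 0ℚ
ratio z (suc n) = z ℚ./ suc n

d : {n : ℕ} → Subset n → ℚ
d {n} X = ratio (+ ∣ X ∣) n

sumFin : (r : ℕ) → (Fin r → ℤ) → ℤ
sumFin zero f = + 0
sumFin (suc r) f = f Fin.zero ℤ.+ sumFin r (λ i → f (Fin.suc i))

aParam : {n r : ℕ} → (A : Fin r → Subset n) → (C : Subset r) → ℚ
aParam {n} {r} A C =
  ratio (sumFin r (λ i → if lookup C i then + 0 else ((+ ⌈ n /2⌉) ℤ.- (+ ∣ A i ∣)))) n

-- ⋂_{i ∈ [k]} A_i  for k ≤ r (empty intersection = [n])
interFirst : {n r : ℕ} → (A : Fin r → Subset n) → (k : ℕ) → k ≤ r → Subset n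
interFirst A k k≤r = ⋂ (List.tabulate (λ (i : Fin k) → A (inject≤ i k≤r)))

-- Write c = ⌈n/2⌉ and D = Σ_{i<k} (c − |A_i|).  A set X of type (c) lies in
-- {x ∈ [n] : x ≥ |X|}, so |X| ≤ c; since |A_i| ≥ c − D, the sets A_1, …, A_k all lie in
-- W = {x : x ≥ c − D}, and |W| ≤ c + D + 1.  Counting inside W,
-- |⋂ A_i| ≥ Σ |A_i| − (k − 1)|W| = kc − D − (k − 1)|W| ≥ c − kD − k.
-- Sets of type (b) also have at most c elements, so every summand of a·n is nonnegative and
-- D ≤ a·n.  Dividing by n gives d(⋂ A_i) ≥ 1/2 − ka − k/n, and k/n ≤ ε once n ≥ r·den(ε).

module Submission where

module Counting where

  open import Defs
  open import Algebra.Bundles using (CommutativeMonoid)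
  import Algebra.Properties.CommutativeSemigroup as CommSemigroupProperties
  open import Data.Bool using (true; false; if_then_else_)
  open import Data.Empty using (⊥-elim)
  open import Data.Fin as Fin using (Fin; inject≤)
  open import Data.Fin.Subset
  open import Data.Fin.Subset.Properties
  open import Data.Integer as ℤ using (ℤ; +_; +≤+)
  import Data.Integer.Properties as ℤP
  open import Data.List using (List; []; _∷_; map; length; tabulate)
  open import Data.List.Properties using (map-tabulate)
  open import Data.List.Relation.Unary.All as All using (All; []; _∷_)
  open import Data.Nat using (ℕ; zero; suc; _+_; _*_; _∸_; _≤_; z≤n; s≤s; ⌈_/2⌉; ⌊_/2⌋; _%_)
  open import Data.Nat.ListAction using (sum)
  open import Data.Nat.Properties
  open import Data.Nat.Tactic.RingSolver using (solve-∀)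
  open import Data.Product using (_,_)
  open import Data.Sum using ([_,_])
  open import Data.Vec using ([]; _∷_; here; there; lookup)
  open import Data.Vec.Properties using ([]=⇒lookup; lookup⇒[]=)
  open import Function using (_∘_)
  open import Relation.Nullary using (yes; no)
  open import Relation.Binary.PropositionalEquality hiding ([_])

  module ℕ+ = CommSemigroupProperties +-commutativeSemigroup

  ∣p∪q∣+∣p∩q∣≡∣p∣+∣q∣ : ∀ {n} (p q : Subset n) → ∣ p ∪ q ∣ + ∣ p ∩ q ∣ ≡ ∣ p ∣ + ∣ q ∣
  ∣p∪q∣+∣p∩q∣≡∣p∣+∣q∣ []            []            = refl
  ∣p∪q∣+∣p∩q∣≡∣p∣+∣q∣ (inside  ∷ p) (inside  ∷ q) = cong suc (begin
    ∣ p ∪ q ∣ + suc (∣ p ∩ q ∣)  ≡⟨ +-suc ∣ p ∪ q ∣ ∣ p ∩ q ∣ ⟩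
    suc (∣ p ∪ q ∣ + ∣ p ∩ q ∣)  ≡⟨ cong suc (∣p∪q∣+∣p∩q∣≡∣p∣+∣q∣ p q) ⟩
    suc (∣ p ∣ + ∣ q ∣)          ≡⟨ +-suc ∣ p ∣ ∣ q ∣ ⟨
    ∣ p ∣ + suc (∣ q ∣)          ∎)
    where open ≡-Reasoning
  ∣p∪q∣+∣p∩q∣≡∣p∣+∣q∣ (inside  ∷ p) (outside ∷ q) = cong suc (∣p∪q∣+∣p∩q∣≡∣p∣+∣q∣ p q)
  ∣p∪q∣+∣p∩q∣≡∣p∣+∣q∣ (outside ∷ p) (inside  ∷ q) =
    trans (cong suc (∣p∪q∣+∣p∩q∣≡∣p∣+∣q∣ p q)) (sym (+-suc ∣ p ∣ ∣ q ∣))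
  ∣p∪q∣+∣p∩q∣≡∣p∣+∣q∣ (outside ∷ p) (outside ∷ q) = ∣p∪q∣+∣p∩q∣≡∣p∣+∣q∣ p q

  ∪-lub : ∀ {n} {p q r : Subset n} → p ⊆ r → q ⊆ r → p ∪ q ⊆ r
  ∪-lub {p = p} {q} p⊆r q⊆r x∈p∪q = [ p⊆r , q⊆r ] (x∈p∪q⁻ p q x∈p∪q)

  ∣p∣+∣q∣≤∣p∩q∣+∣r∣ : ∀ {n} {p q r : Subset n} → p ⊆ r → q ⊆ r →
    ∣ p ∣ + ∣ q ∣ ≤ ∣ p ∩ q ∣ + ∣ r ∣
  ∣p∣+∣q∣≤∣p∩q∣+∣r∣ {p = p} {q} {r} p⊆r q⊆r = begin
    ∣ p ∣ + ∣ q ∣          ≡⟨ ∣p∪q∣+∣p∩q∣≡∣p∣+∣q∣ p q ⟨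
    ∣ p ∪ q ∣ + ∣ p ∩ q ∣  ≤⟨ +-monoˡ-≤ ∣ p ∩ q ∣ (p⊆q⇒∣p∣≤∣q∣ (∪-lub p⊆r q⊆r)) ⟩
    ∣ r ∣ + ∣ p ∩ q ∣      ≡⟨ +-comm ∣ r ∣ ∣ p ∩ q ∣ ⟩
    ∣ p ∩ q ∣ + ∣ r ∣      ∎
    where open ≤-Reasoning

  ∣⋂∣-lower-bound : ∀ {n} (W : Subset n) (Xs : List (Subset n)) → All (_⊆ W) Xs →
    ∣ W ∣ + sum (map ∣_∣ Xs) ≤ ∣ W ∩ ⋂ Xs ∣ + length Xs * ∣ W ∣
  ∣⋂∣-lower-bound W [] [] = begin
    ∣ W ∣ + 0       ≡⟨ cong (λ V → ∣ V ∣ + 0) (∩-identityʳ W) ⟨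
    ∣ W ∩ ⊤ ∣ + 0   ∎
    where open ≤-Reasoning
  ∣⋂∣-lower-bound W (X ∷ Xs) (X⊆W ∷ Xs⊆W) = begin
    w + (∣ X ∣ + ΣXs)                 ≡⟨ ℕ+.x∙yz≈y∙xz w ∣ X ∣ ΣXs ⟩
    ∣ X ∣ + (w + ΣXs)                 ≤⟨ +-monoʳ-≤ ∣ X ∣ (∣⋂∣-lower-bound W Xs Xs⊆W) ⟩
    ∣ X ∣ + (∣ W ∩ R ∣ + l * w)       ≡⟨ +-assoc ∣ X ∣ ∣ W ∩ R ∣ (l * w) ⟨
    ∣ X ∣ + ∣ W ∩ R ∣ + l * w         ≤⟨ +-monoˡ-≤ (l * w) (∣p∣+∣q∣≤∣p∩q∣+∣r∣ X⊆W (p∩q⊆p W R)) ⟩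
    ∣ X ∩ (W ∩ R) ∣ + w + l * w       ≡⟨ cong (λ V → ∣ V ∣ + w + l * w) (∩.x∙yz≈y∙xz X W R) ⟩
    ∣ W ∩ (X ∩ R) ∣ + w + l * w       ≡⟨ +-assoc ∣ W ∩ (X ∩ R) ∣ w (l * w) ⟩
    ∣ W ∩ (X ∩ R) ∣ + (w + l * w)     ∎
    where
    open ≤-Reasoning
    R = ⋂ Xs
    l = length Xs
    w = ∣ W ∣
    ΣXs = sum (map ∣_∣ Xs)
    module ∩ = CommSemigroupProperties
                 (CommutativeMonoid.commutativeSemigroup (∩-commutativeMonoid _))

  atLeast : (n t : ℕ) → Subset n
  atLeast zero    _             = []
  atLeast (suc n) zero          = ⊤
  atLeast (suc n) (suc zero)    = ⊤
  atLeast (suc n) (suc (suc t)) = outside ∷ atLeast n (suc t)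

  x∈atLeast : ∀ {n} t (i : Fin n) → t ≤ val i → i ∈ atLeast n t
  x∈atLeast {suc n} zero          _            _          = ∈⊤
  x∈atLeast {suc n} (suc zero)    _            _          = ∈⊤
  x∈atLeast {suc n} (suc (suc t)) Fin.zero     (s≤s ())
  x∈atLeast {suc n} (suc (suc t)) (Fin.suc i)  (s≤s t<i)  = there (x∈atLeast (suc t) i t<i)

  ∣atLeast∣+t≤1+n : ∀ n t → t ≤ suc n → ∣ atLeast n t ∣ + t ≤ suc n
  ∣atLeast∣+t≤1+n zero    t             t≤1       = t≤1
  ∣atLeast∣+t≤1+n (suc n) zero          _         =
    ≤-trans (≤-reflexive (trans (+-identityʳ _) (∣⊤∣≡n (suc n)))) (n≤1+n (suc n))
  ∣atLeast∣+t≤1+n (suc n) (suc zero)    _         =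
    ≤-reflexive (trans (+-comm _ 1) (cong suc (∣⊤∣≡n (suc n))))
  ∣atLeast∣+t≤1+n (suc n) (suc (suc t)) (s≤s t<n) =
    subst (_≤ suc (suc n)) (sym (+-suc _ (suc t))) (s≤s (∣atLeast∣+t≤1+n n (suc t) t<n))

  typeC⇒⊆atLeast : ∀ {n t} {X : Subset n} → TypeC X → t ≤ ∣ X ∣ → X ⊆ atLeast n t
  typeC⇒⊆atLeast {t = t} tc t≤∣X∣ {i} i∈X = x∈atLeast t i (≤-trans t≤∣X∣ (tc i i∈X))

  m+m≤1+n⇒m≤⌈n/2⌉ : ∀ {m n} → m + m ≤ suc n → m ≤ ⌈ n /2⌉
  m+m≤1+n⇒m≤⌈n/2⌉ {m} h = subst (_≤ _) (sym (n≡⌊n+n/2⌋ m)) (⌊n/2⌋-mono h)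

  typeC⇒∣X∣≤⌈n/2⌉ : ∀ {n} {X : Subset n} → TypeC X → ∣ X ∣ ≤ ⌈ n /2⌉
  typeC⇒∣X∣≤⌈n/2⌉ {n} {X} tc = m+m≤1+n⇒m≤⌈n/2⌉ (begin
    ∣ X ∣ + ∣ X ∣                  ≤⟨ +-monoˡ-≤ ∣ X ∣ (p⊆q⇒∣p∣≤∣q∣ (typeC⇒⊆atLeast tc ≤-refl)) ⟩
    ∣ atLeast n (∣ X ∣) ∣ + ∣ X ∣  ≤⟨ ∣atLeast∣+t≤1+n n ∣ X ∣ (m≤n⇒m≤1+n (∣p∣≤n X)) ⟩
    suc n                          ∎)
    where open ≤-Reasoning

  odd⇒∣X∣≤⌈n/2⌉ : ∀ {n} (X : Subset n) →
    (∀ i → i ∈ X → val i % 2 ≡ 1) → ∣ X ∣ ≤ ⌈ n /2⌉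
  even⇒∣X∣≤⌊n/2⌋ : ∀ {n} (X : Subset n) →
    (∀ i → i ∈ X → suc (val i) % 2 ≡ 1) → ∣ X ∣ ≤ ⌊ n /2⌋
  odd⇒∣X∣≤⌈n/2⌉ [] _ = z≤n
  odd⇒∣X∣≤⌈n/2⌉ (inside ∷ X) odd =
    s≤s (even⇒∣X∣≤⌊n/2⌋ X (λ i i∈X → odd (Fin.suc i) (there i∈X)))
  odd⇒∣X∣≤⌈n/2⌉ {suc n} (outside ∷ X) odd =
    m≤n⇒m≤1+n (even⇒∣X∣≤⌊n/2⌋ X (λ i i∈X → odd (Fin.suc i) (there i∈X)))
  even⇒∣X∣≤⌊n/2⌋ [] _ = z≤n
  even⇒∣X∣≤⌊n/2⌋ (inside ∷ X) even with () ← even Fin.zero here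
  even⇒∣X∣≤⌊n/2⌋ (outside ∷ X) even = odd⇒∣X∣≤⌈n/2⌉ X (λ i i∈X → even (Fin.suc i) (there i∈X))

  m∸n≤o⇒m∸o≤n : ∀ {m n o} → m ∸ n ≤ o → m ∸ o ≤ n
  m∸n≤o⇒m∸o≤n {m} {n} {o} h = m≤n+o⇒m∸n≤o m o (begin
    m            ≤⟨ m≤n+m∸n m n ⟩
    n + (m ∸ n)  ≤⟨ +-monoʳ-≤ n h ⟩
    n + o        ≡⟨ +-comm n o ⟩
    o + n        ∎)
    where open ≤-Reasoning

  All-≤-sum : ∀ {a} {A : Set a} (f : A → ℕ) (xs : List A) →
    All (λ x → f x ≤ sum (map f xs)) xs
  All-≤-sum f []       = []
  All-≤-sum f (x ∷ xs) =
    m≤m+n (f x) _ ∷ All.map (λ h → ≤-trans h (m≤n+m _ (f x))) (All-≤-sum f xs)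

  deficit : ∀ {n} → Subset n → ℕ
  deficit {n} X = ⌈ n /2⌉ ∸ ∣ X ∣

  sum-∣∣+sum-deficit : ∀ {n} (Xs : List (Subset n)) → All (λ X → ∣ X ∣ ≤ ⌈ n /2⌉) Xs →
    sum (map ∣_∣ Xs) + sum (map deficit Xs) ≡ length Xs * ⌈ n /2⌉
  sum-∣∣+sum-deficit []       []           = refl
  sum-∣∣+sum-deficit {n} (X ∷ Xs) (X≤c ∷ Xs≤c) = begin
    (∣ X ∣ + Σ) + (deficit X + Σd)      ≡⟨ ℕ+.interchange ∣ X ∣ Σ (deficit X) Σd ⟩
    (∣ X ∣ + deficit X) + (Σ + Σd)      ≡⟨ cong₂ _+_ (m+[n∸m]≡n X≤c) (sum-∣∣+sum-deficit Xs Xs≤c) ⟩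
    ⌈ n /2⌉ + length Xs * ⌈ n /2⌉       ∎
    where
    open ≡-Reasoning
    Σ = sum (map ∣_∣ Xs)
    Σd = sum (map deficit Xs)

  intersection-arith : ∀ {k I w S D c n} →
    (∩-bound : w + S ≤ I + suc k * w) (W-bound : w + (c ∸ D) ≤ suc n) (n≤2c : n ≤ c + c)
    (S+D≡kc : S + D ≡ suc k * c) → c ≤ I + suc k * D + suc k
  intersection-arith {k} {I} {w} {S} {D} {c} {n} ∩-bound W-bound n≤2c S+D≡kc =
    +-cancelˡ-≤ (k * c) c _ (begin
      k * c + c                   ≡⟨ +-comm (k * c) c ⟩
      suc k * c                   ≡⟨ S+D≡kc ⟨
      S + D                       ≤⟨ +-monoˡ-≤ D S≤ ⟩
      I + k * w + D               ≤⟨ +-monoˡ-≤ D (+-monoʳ-≤ I (*-monoʳ-≤ k w≤)) ⟩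
      I + k * (c + suc D) + D     ≡⟨ rearrange k I c D ⟩
      k * c + (I + suc k * D + k) ≤⟨ +-monoʳ-≤ (k * c) (n≤1+n _) ⟩
      k * c + suc (I + suc k * D + k) ≡⟨ cong (λ x → k * c + x) (+-suc _ k) ⟨
      k * c + (I + suc k * D + suc k) ∎)
    where
    open ≤-Reasoning
    rearrange : ∀ k I c D → I + k * (c + suc D) + D ≡ k * c + (I + suc k * D + k)
    rearrange = solve-∀
    rearrange′ : ∀ c D → suc (c + c) + D ≡ c + suc D + c
    rearrange′ = solve-∀
    S≤ : S ≤ I + k * w
    S≤ = +-cancelˡ-≤ w S _ (≤-trans ∩-bound (≤-reflexive (ℕ+.x∙yz≈y∙xz I w (k * w))))
    w≤ : w ≤ c + suc D
    w≤ = +-cancelʳ-≤ c w _ (begin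
      w + c               ≤⟨ +-monoʳ-≤ w (m≤n+m∸n c D) ⟩
      w + (D + (c ∸ D))   ≡⟨ cong (λ x → w + x) (+-comm D (c ∸ D)) ⟩
      w + (c ∸ D + D)     ≡⟨ +-assoc w (c ∸ D) D ⟨
      w + (c ∸ D) + D     ≤⟨ +-monoˡ-≤ D W-bound ⟩
      suc n + D           ≤⟨ +-monoˡ-≤ D (s≤s n≤2c) ⟩
      suc (c + c) + D     ≡⟨ rearrange′ c D ⟩
      c + suc D + c       ∎)

  n≤⌈n/2⌉+⌈n/2⌉ : ∀ n → n ≤ ⌈ n /2⌉ + ⌈ n /2⌉
  n≤⌈n/2⌉+⌈n/2⌉ n = begin
    n                     ≡⟨ ⌊n/2⌋+⌈n/2⌉≡n n ⟨
    ⌊ n /2⌋ + ⌈ n /2⌉     ≤⟨ +-monoˡ-≤ ⌈ n /2⌉ (⌊n/2⌋≤⌈n/2⌉ n) ⟩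
    ⌈ n /2⌉ + ⌈ n /2⌉     ∎
    where open ≤-Reasoning

  typeC⇒⌈n/2⌉≤∣⋂∣+kD+k : ∀ {n} (Xs : List (Subset n)) → All TypeC Xs →
    ⌈ n /2⌉ ≤ ∣ ⋂ Xs ∣ + length Xs * sum (map deficit Xs) + length Xs
  typeC⇒⌈n/2⌉≤∣⋂∣+kD+k {n} [] [] = begin
    ⌈ n /2⌉            ≤⟨ ⌈n/2⌉≤n n ⟩
    n                  ≡⟨ ∣⊤∣≡n n ⟨
    ∣ ⊤ {n} ∣          ≡⟨ +-identityʳ _ ⟨
    ∣ ⊤ {n} ∣ + 0      ≡⟨ +-identityʳ _ ⟨
    ∣ ⊤ {n} ∣ + 0 + 0  ∎
    where open ≤-Reasoning
  typeC⇒⌈n/2⌉≤∣⋂∣+kD+k {n} Xs@(_ ∷ Ys) tcs =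
    intersection-arith {I = ∣ ⋂ Xs ∣} {S = sum (map ∣_∣ Xs)} {D} ∩-bound W-bound (n≤⌈n/2⌉+⌈n/2⌉ n)
      (sum-∣∣+sum-deficit Xs (All.map typeC⇒∣X∣≤⌈n/2⌉ tcs))
    where
    c = ⌈ n /2⌉
    D = sum (map deficit Xs)
    W = atLeast n (c ∸ D)
    Xs⊆W : All (_⊆ W) Xs
    Xs⊆W = All.zipWith (λ (tc , deficit≤D) {_} → typeC⇒⊆atLeast tc (m∸n≤o⇒m∸o≤n deficit≤D))
                       (tcs , All-≤-sum deficit Xs)
    ∩-bound : ∣ W ∣ + sum (map ∣_∣ Xs) ≤ ∣ ⋂ Xs ∣ + suc (length Ys) * ∣ W ∣
    ∩-bound = ≤-trans (∣⋂∣-lower-bound W Xs Xs⊆W) (+-monoˡ-≤ _ (∣p∩q∣≤∣q∣ W (⋂ Xs)))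
    W-bound : ∣ W ∣ + (c ∸ D) ≤ suc n
    W-bound = ∣atLeast∣+t≤1+n n (c ∸ D) (≤-trans (m∸n≤m c D) (≤-trans (⌈n/2⌉≤n n) (n≤1+n n)))

  sumFin-nonneg : ∀ r (f : Fin r → ℤ) → (∀ i → + 0 ℤ.≤ f i) → + 0 ℤ.≤ sumFin r f
  sumFin-nonneg zero    f f≥0 = ℤP.≤-refl
  sumFin-nonneg (suc r) f f≥0 =
    ℤP.+-mono-≤ (f≥0 Fin.zero) (sumFin-nonneg r (f ∘ Fin.suc) (f≥0 ∘ Fin.suc))

  sumFin-inject≤ : ∀ {k r} (f : Fin r → ℤ) → (∀ i → + 0 ℤ.≤ f i) → (k≤r : k ≤ r) →
    sumFin k (λ j → f (inject≤ j k≤r)) ℤ.≤ sumFin r f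
  sumFin-inject≤ {zero}  f f≥0 _         = sumFin-nonneg _ f f≥0
  sumFin-inject≤ {suc k} f f≥0 (s≤s k≤r) =
    ℤP.+-monoʳ-≤ (f Fin.zero) (sumFin-inject≤ (f ∘ Fin.suc) (f≥0 ∘ Fin.suc) k≤r)

  sumFin≡sum-tabulate : ∀ k (f : Fin k → ℤ) (g : Fin k → ℕ) → (∀ j → f j ≡ + g j) →
    sumFin k f ≡ + sum (tabulate g)
  sumFin≡sum-tabulate zero    f g f≡g = refl
  sumFin≡sum-tabulate (suc k) f g f≡g = begin
    f Fin.zero ℤ.+ sumFin k (f ∘ Fin.suc)
      ≡⟨ cong₂ ℤ._+_ (f≡g Fin.zero) (sumFin≡sum-tabulate k _ _ (f≡g ∘ Fin.suc)) ⟩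
    + g Fin.zero ℤ.+ + sum (tabulate (g ∘ Fin.suc))
      ≡⟨ ℤP.pos-+ (g Fin.zero) _ ⟨
    + sum (tabulate g)
      ∎
    where open ≡-Reasoning

  aTerm : ∀ {n r} → (Fin r → Subset n) → Subset r → Fin r → ℤ
  aTerm {n} A C i = if lookup C i then + 0 else (+ ⌈ n /2⌉) ℤ.- (+ ∣ A i ∣)

  aTerm-∉ : ∀ {n r} (A : Fin r → Subset n) (C : Subset r) {i} → i ∉ C → ∣ A i ∣ ≤ ⌈ n /2⌉ →
    aTerm A C i ≡ + deficit (A i)
  aTerm-∉ {n} A C {i} i∉C ∣A∣≤c with lookup C i in eq
  ... | true  = ⊥-elim (i∉C (lookup⇒[]= i C eq))
  ... | false = trans (ℤP.m-n≡m⊖n ⌈ n /2⌉ ∣ A i ∣) (ℤP.⊖-≥ ∣A∣≤c)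

  aTerm-nonneg : ∀ {n r} (A : Fin r → Subset n) (C : Subset r) →
    (∀ i → i ∉ C → ∣ A i ∣ ≤ ⌈ n /2⌉) → ∀ i → + 0 ℤ.≤ aTerm A C i
  aTerm-nonneg A C small i with i ∈? C
  ... | yes i∈C = subst (λ b → + 0 ℤ.≤ (if b then _ else _)) (sym ([]=⇒lookup i∈C)) ℤP.≤-refl
  ... | no  i∉C = subst (+ 0 ℤ.≤_) (sym (aTerm-∉ A C i∉C (small i i∉C))) (+≤+ z≤n)

  sum-deficit≤sumFin-aTerm : ∀ {n r k} (A : Fin r → Subset n) (C : Subset r) (k≤r : k ≤ r) →
    (∀ i → i ∉ C → ∣ A i ∣ ≤ ⌈ n /2⌉) → (∀ j → inject≤ j k≤r ∉ C) →
    + sum (map deficit (tabulate (λ j → A (inject≤ j k≤r)))) ℤ.≤ sumFin r (aTerm A C)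
  sum-deficit≤sumFin-aTerm {k = k} A C k≤r small prefix∉C = begin
    + sum (map deficit (tabulate (A ∘ inj)))
      ≡⟨ cong (λ xs → + sum xs) (map-tabulate (A ∘ inj) deficit) ⟩
    + sum (tabulate (deficit ∘ A ∘ inj))
      ≡⟨ sumFin≡sum-tabulate k _ _ (λ j → aTerm-∉ A C (prefix∉C j) (small _ (prefix∉C j))) ⟨
    sumFin k (aTerm A C ∘ inj)
      ≤⟨ sumFin-inject≤ (aTerm A C) (aTerm-nonneg A C small) k≤r ⟩
    sumFin _ (aTerm A C)
      ∎
    where
    open ℤP.≤-Reasoning
    inj = λ j → inject≤ j k≤r

module Fractions where

  open import Data.Nat as ℕ using (suc; ⌈_/2⌉; ⌊_/2⌋)
  import Data.Nat.Properties as ℕP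
  open import Data.Integer as ℤ using (ℤ; +_; +[1+_]; -[1+_])
  import Data.Integer.Properties as ℤP
  open import Data.Integer.Tactic.RingSolver using (solve-∀)
  open import Data.Rational
  open import Data.Rational.Properties
  open import Data.Rational.Unnormalised as ℚᵘ using (mkℚᵘ; *≡*; *≤*) renaming (_≃_ to _≃ᵘ_)
  import Data.Rational.Unnormalised.Properties as ℚᵘP
  open import Relation.Binary.PropositionalEquality

  toℚᵘ-/ : ∀ z n → toℚᵘ (z / suc n) ≃ᵘ mkℚᵘ z n
  toℚᵘ-/ z n = toℚᵘ-fromℚᵘ (mkℚᵘ z n)

  /≤/ : ∀ {x y m n} → x ℤ.* + suc n ℤ.≤ y ℤ.* + suc m → x / suc m ≤ y / suc n
  /≤/ {x} {y} {m} {n} h = toℚᵘ-cancel-≤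
    (ℚᵘP.≤-respˡ-≃ (ℚᵘP.≃-sym (toℚᵘ-/ x m))
      (ℚᵘP.≤-respʳ-≃ (ℚᵘP.≃-sym (toℚᵘ-/ y n)) (*≤* h)))

  /-distrib-+ : ∀ x y n → (x ℤ.+ y) / suc n ≡ x / suc n + y / suc n
  /-distrib-+ x y n = toℚᵘ-injective (begin
    toℚᵘ ((x ℤ.+ y) / suc n)
      ≈⟨ toℚᵘ-/ (x ℤ.+ y) n ⟩
    mkℚᵘ (x ℤ.+ y) n
      ≈⟨ *≡* (trans (cong ((x ℤ.+ y) ℤ.*_) (ℤP.pos-* (suc n) (suc n))) (cross x y (+ suc n))) ⟩
    mkℚᵘ x n ℚᵘ.+ mkℚᵘ y n
      ≈⟨ ℚᵘP.+-cong (ℚᵘP.≃-sym (toℚᵘ-/ x n)) (ℚᵘP.≃-sym (toℚᵘ-/ y n)) ⟩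
    toℚᵘ (x / suc n) ℚᵘ.+ toℚᵘ (y / suc n)
      ≈⟨ ℚᵘP.≃-sym (toℚᵘ-homo-+ (x / suc n) (y / suc n)) ⟩
    toℚᵘ (x / suc n + y / suc n)
      ∎)
    where
    open ℚᵘP.≃-Reasoning
    cross : ∀ x y N → (x ℤ.+ y) ℤ.* (N ℤ.* N) ≡ (x ℤ.* N ℤ.+ y ℤ.* N) ℤ.* N
    cross = solve-∀

  [a/1]*[z/n]≡[a*z]/n : ∀ a z n → (a / 1) * (z / suc n) ≡ (a ℤ.* z) / suc n
  [a/1]*[z/n]≡[a*z]/n a z n = toℚᵘ-injective (begin
    toℚᵘ ((a / 1) * (z / suc n))
      ≈⟨ toℚᵘ-homo-* (a / 1) (z / suc n) ⟩
    toℚᵘ (a / 1) ℚᵘ.* toℚᵘ (z / suc n)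
      ≈⟨ ℚᵘP.*-cong (toℚᵘ-/ a 0) (toℚᵘ-/ z n) ⟩
    mkℚᵘ a 0 ℚᵘ.* mkℚᵘ z n
      ≈⟨ *≡* (cong (λ m → (a ℤ.* z) ℤ.* + suc m) (sym (ℕP.+-identityʳ n))) ⟩
    mkℚᵘ (a ℤ.* z) n
      ≈⟨ ℚᵘP.≃-sym (toℚᵘ-/ (a ℤ.* z) n) ⟩
    toℚᵘ ((a ℤ.* z) / suc n)
      ∎)
    where open ℚᵘP.≃-Reasoning

  k*↧ε≤n⇒k/n≤ε : ∀ {k n ε} → 0ℚ < ε → k ℕ.* ↧ₙ ε ℕ.≤ suc n → + k / suc n ≤ ε
  k*↧ε≤n⇒k/n≤ε {k} {n} {ε@(mkℚ +[1+ p ] q _)} _ kq≤n =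
    subst (+ k / suc n ≤_) (↥p/↧p≡p ε)
      (/≤/ {+ k} {+[1+ p ]} (subst₂ ℤ._≤_ (ℤP.pos-* k (suc q)) (ℤP.pos-* (suc p) (suc n))
        (ℤ.+≤+ (ℕP.≤-trans kq≤n (ℕP.m≤n*m (suc n) (suc p))))))
  k*↧ε≤n⇒k/n≤ε {ε = mkℚ (+ 0) _ _} (*<* (ℤ.+<+ ()))
  k*↧ε≤n⇒k/n≤ε {ε = mkℚ -[1+ _ ] _ _} (*<* ())

  p≤q+r⇒p-r≤q : ∀ {p q r} → p ≤ q + r → p - r ≤ q
  p≤q+r⇒p-r≤q {p} {q} {r} h = begin
    p - r         ≤⟨ +-monoˡ-≤ (- r) h ⟩
    q + r - r     ≡⟨ +-assoc q r (- r) ⟩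
    q + (r - r)   ≡⟨ cong (λ x → q + x) (+-inverseʳ r) ⟩
    q + 0ℚ        ≡⟨ +-identityʳ q ⟩
    q             ∎
    where open ≤-Reasoning

  ⌈n/2⌉≤m⇒½≤m/n : ∀ {m n} → ⌈ suc n /2⌉ ℕ.≤ m → ½ ≤ + m / suc n
  ⌈n/2⌉≤m⇒½≤m/n {m} {n} h = /≤/ {+ 1} {+ m} {1} {n}
    (subst₂ ℤ._≤_ (sym (ℤP.*-identityˡ (+ suc n))) (ℤP.pos-* m 2) (ℤ.+≤+ N≤m*2))
    where
    N≤m*2 : suc n ℕ.≤ m ℕ.* 2
    N≤m*2 = begin
      suc n                         ≡⟨ ℕP.⌊n/2⌋+⌈n/2⌉≡n (suc n) ⟨
      ⌊ suc n /2⌋ ℕ.+ ⌈ suc n /2⌉   ≤⟨ ℕP.+-mono-≤ (ℕP.≤-trans (ℕP.⌊n/2⌋≤⌈n/2⌉ _) h) h ⟩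
      m ℕ.+ m                       ≡⟨ cong (m ℕ.+_) (ℕP.+-identityʳ m) ⟨
      2 ℕ.* m                       ≡⟨ ℕP.*-comm 2 m ⟩
      m ℕ.* 2                       ∎
      where open ℕP.≤-Reasoning

  pos-[i+k*d+k] : ∀ I k D → + (I ℕ.+ k ℕ.* D ℕ.+ k) ≡ + I ℤ.+ (+ k ℤ.* + D ℤ.+ + k)
  pos-[i+k*d+k] I k D = begin
    + (I ℕ.+ k ℕ.* D ℕ.+ k)        ≡⟨ ℤP.pos-+ (I ℕ.+ k ℕ.* D) k ⟩
    + (I ℕ.+ k ℕ.* D) ℤ.+ + k      ≡⟨ cong (ℤ._+ + k) (ℤP.pos-+ I (k ℕ.* D)) ⟩
    + I ℤ.+ + (k ℕ.* D) ℤ.+ + k    ≡⟨ cong (λ x → + I ℤ.+ x ℤ.+ + k) (ℤP.pos-* k D) ⟩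
    + I ℤ.+ + k ℤ.* + D ℤ.+ + k    ≡⟨ ℤP.+-assoc (+ I) (+ k ℤ.* + D) (+ k) ⟩
    + I ℤ.+ (+ k ℤ.* + D ℤ.+ + k)  ∎
    where open ≡-Reasoning

  ½-k*a-ε≤i/n : ∀ {n k I D} (S : ℤ) {ε} → 0ℚ < ε → k ℕ.* ↧ₙ ε ℕ.≤ suc n →
    ⌈ suc n /2⌉ ℕ.≤ I ℕ.+ k ℕ.* D ℕ.+ k → + D ℤ.≤ S →
    ½ - (+ k / 1) * (S / suc n) - ε ≤ + I / suc n
  ½-k*a-ε≤i/n {n} {k} {I} {D} S {ε} ε>0 kq≤N half≤ D≤S = begin
    ½ - K * (S / N) - ε           ≡⟨ +-assoc ½ (- (K * (S / N))) (- ε) ⟩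
    ½ + (- (K * (S / N)) - ε)     ≡⟨ cong (λ x → ½ + x) (neg-distrib-+ (K * (S / N)) ε) ⟨
    ½ - (K * (S / N) + ε)         ≤⟨ p≤q+r⇒p-r≤q ½≤ ⟩
    + I / N                       ∎
    where
    open ≤-Reasoning
    N = suc n
    K = + k / 1
    kD/N≤k*a : K * (+ D / N) ≤ K * (S / N)
    kD/N≤k*a = *-monoˡ-≤-nonNeg K {{normalize-nonNeg k 1}}
      (/≤/ {+ D} {S} (ℤP.*-monoʳ-≤-nonNeg (+ N) D≤S))
    ½≤ : ½ ≤ + I / N + (K * (S / N) + ε)
    ½≤ = begin
      ½
        ≤⟨ ⌈n/2⌉≤m⇒½≤m/n half≤ ⟩
      + (I ℕ.+ k ℕ.* D ℕ.+ k) / N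
        ≡⟨ cong (_/ N) (pos-[i+k*d+k] I k D) ⟩
      (+ I ℤ.+ (+ k ℤ.* + D ℤ.+ + k)) / N
        ≡⟨ /-distrib-+ (+ I) (+ k ℤ.* + D ℤ.+ + k) n ⟩
      + I / N + (+ k ℤ.* + D ℤ.+ + k) / N
        ≡⟨ cong (λ x → + I / N + x) (/-distrib-+ (+ k ℤ.* + D) (+ k) n) ⟩
      + I / N + ((+ k ℤ.* + D) / N + + k / N)
        ≡⟨ cong (λ x → + I / N + (x + + k / N)) ([a/1]*[z/n]≡[a*z]/n (+ k) (+ D) n) ⟨
      + I / N + (K * (+ D / N) + + k / N)
        ≤⟨ +-monoʳ-≤ (+ I / N) (+-mono-≤ kD/N≤k*a (k*↧ε≤n⇒k/n≤ε {k} {n} ε>0 kq≤N)) ⟩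
      + I / N + (K * (S / N) + ε)
        ∎

open import Defs
open import Data.Nat using (ℕ; _≤_; _<_; _≥_; _>_)
open import Data.Integer using (+_)
open import Data.Rational using (ℚ; 0ℚ; ½; _-_; _*_; _/_)
open import Data.Rational.Base using () renaming (_≤_ to _≤ℚ_; _<_ to _<ℚ_)
open import Data.Fin using (Fin; toℕ)
open import Data.Fin.Subset using (Subset; _∈_; _∉_)
open import Data.Product using (Σ; _×_)
open import Data.Sum using (_⊎_)

import Data.Integer as ℤ
import Data.Nat as ℕ
open import Data.Nat using (⌈_/2⌉)
import Data.Nat.Properties as ℕP
open import Data.Nat.ListAction using (sum)
open import Data.Fin using (inject≤)
open import Data.Fin.Properties using (toℕ-inject≤; toℕ<n)
open import Data.Fin.Subset using (⋂; ∣_∣)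
open import Data.List using (map; tabulate)
open import Data.List.Properties using (length-tabulate)
open import Data.List.Relation.Unary.All.Properties using (tabulate⁺)
open import Data.Product using (_,_)
open import Data.Rational using (↧ₙ_)
open import Data.Sum using ([_,_]′)
open import Function using (_∘_)
open import Relation.Binary.PropositionalEquality using (subst; sym)
open Counting
open Fractions using (½-k*a-ε≤i/n)

density-bound : ∀ {r n} {ε : ℚ} → 0ℚ <ℚ ε → r ℕ.* ↧ₙ ε ≤ ℕ.suc n →
  (A : Fin r → Subset (ℕ.suc n)) (C : Subset r) →
  ((i : Fin r) → i ∉ C → TypeB (A i) ⊎ TypeC (A i)) →
  (k : ℕ) (k≤r : k ≤ r) →
  ((i : Fin r) → toℕ i < k → TypeC (A i)) →
  ((i : Fin r) → toℕ i < k → i ∉ C) →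
  ½ - (+ k / 1) * aParam A C - ε ≤ℚ d (interFirst A k k≤r)
density-bound {r} {n} {ε} ε>0 n₀≤N A C typeB⊎C k k≤r typeC<k ∉C<k =
  ½-k*a-ε≤i/n {n} {k} {∣ ⋂ Xs ∣} (sumFin r (aTerm A C)) ε>0 k↧ε≤N ⌈N/2⌉≤∣⋂Xs∣+kD+k D≤a·N
  where
  inj : Fin k → Fin r
  inj j = inject≤ j k≤r
  inj<k : ∀ j → toℕ (inj j) < k
  inj<k j = subst (_< k) (sym (toℕ-inject≤ j k≤r)) (toℕ<n j)
  Xs = tabulate (A ∘ inj)
  D = sum (map deficit Xs)
  small : ∀ i → i ∉ C → ∣ A i ∣ ≤ ⌈ ℕ.suc n /2⌉
  small i i∉C = [ odd⇒∣X∣≤⌈n/2⌉ (A i) , typeC⇒∣X∣≤⌈n/2⌉ ]′ (typeB⊎C i i∉C)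
  k↧ε≤N : k ℕ.* ↧ₙ ε ≤ ℕ.suc n
  k↧ε≤N = ℕP.≤-trans (ℕP.*-monoˡ-≤ (↧ₙ ε) k≤r) n₀≤N
  ⌈N/2⌉≤∣⋂Xs∣+kD+k : ⌈ ℕ.suc n /2⌉ ≤ ∣ ⋂ Xs ∣ ℕ.+ k ℕ.* D ℕ.+ k
  ⌈N/2⌉≤∣⋂Xs∣+kD+k =
    subst (λ l → ⌈ ℕ.suc n /2⌉ ≤ ∣ ⋂ Xs ∣ ℕ.+ l ℕ.* D ℕ.+ l) (length-tabulate (A ∘ inj))
    (typeC⇒⌈n/2⌉≤∣⋂∣+kD+k Xs (tabulate⁺ (λ j → typeC<k (inj j) (inj<k j))))
  D≤a·N : + D ℤ.≤ sumFin r (aTerm A C)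
  D≤a·N = sum-deficit≤sumFin-aTerm A C k≤r small (λ j → ∉C<k (inj j) (inj<k j))

lemma6p5 : (ε : ℚ) → 0ℚ <ℚ ε → (r : ℕ) → r > 0 →
    Σ ℕ (λ n₀ → n₀ > 0 ×
      ((n : ℕ) → n ≥ n₀ →
        (A : Fin r → Subset n) → ((i : Fin r) → MaximalSumFree (A i)) →
        (C : Subset r) →
        ((i : Fin r) → i ∈ C → TypeA (A i)) →
        ((i : Fin r) → i ∉ C → TypeB (A i) ⊎ TypeC (A i)) →
        (k : ℕ) → (k≤r : k ≤ r) →
        ((i : Fin r) → toℕ i < k → TypeC (A i)) →
        ((i : Fin r) → toℕ i < k → i ∉ C) →
        ½ - (+ k / 1) * aParam A C - ε ≤ℚ d (interFirst A k k≤r)))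
lemma6p5 ε ε>0 r@(ℕ.suc _) _ = r ℕ.* ↧ₙ ε , ℕ.z<s , λ where
  ℕ.zero    ()
  (ℕ.suc n) n₀≤N A _ C _ typeB⊎C k k≤r typeC<k ∉C<k →
    density-bound ε>0 n₀≤N A C typeB⊎C k k≤r typeC<k ∉C<k
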